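{- Let $n\ge 3$ and let $\pi,\pi'$ be permutations of $[n]=\{1,\dots,n\}$. Let $\gamma$ be the cyclic permutation $1\mapsto 2\mapsto\cdots\mapsto n\mapsto 1$. Then $\pi'\neq\pi$ if and only if $\pi'=\gamma^{ -j}\circ \rho\circ \gamma^k\circ\pi$ for some integers $j,k$ with $0\leq j < k < n$ and some permutation $\rho$ of $[n]$ satisfying $\rho(n)=n$.
   Context: Composition is $(f\circ g)(i)=f(g(i))$. -}

module Defs where

open import Data.Nat using (ℕ; zero; suc)
open import Data.Fin using (Fin; zero; suc; fromℕ; inject₁)
open import Data.Fin.Permutation using (Permutation′; permutation; _⟨$⟩ʳ_; _⟨$⟩ˡ_)
open import Relation.Binary.PropositionalEquality using (_≡_; refl; cong)

-- Elements of [n] = {1,…,n} are represented by Fin n = {0,…,n-1}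
-- (element i of [n] is the Fin-element with toℕ = i - 1).
-- We work with n = suc m, so the element n of [n] is  fromℕ m.

succ-wrap : ∀ {m} → Fin (suc m) → Fin (suc m)
succ-wrap {zero} zero = zero
succ-wrap {suc m} zero = suc zero
succ-wrap {suc m} (suc i) with succ-wrap {m} i
... | zero = zero
... | suc j = suc (suc j)

pred-wrap : ∀ {m} → Fin (suc m) → Fin (suc m)
pred-wrap {m} zero = fromℕ m
pred-wrap {m} (suc i) = inject₁ i

private
  succ-last : ∀ m → succ-wrap (fromℕ m) ≡ zero
  succ-last zero = refl
  succ-last (suc m) rewrite succ-last m = refl

  succ-inj : ∀ {m} (i : Fin m) → succ-wrap (inject₁ i) ≡ suc i
  succ-inj {suc m} zero = refl
  succ-inj {suc m} (suc i) rewrite succ-inj i = refl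

  succ-pred : ∀ {m} (i : Fin (suc m)) → succ-wrap (pred-wrap i) ≡ i
  succ-pred {m} zero = succ-last m
  succ-pred {m} (suc i) = succ-inj i

  pred-succ : ∀ {m} (i : Fin (suc m)) → pred-wrap (succ-wrap i) ≡ i
  pred-succ {zero} zero = refl
  pred-succ {suc m} zero = refl
  pred-succ {suc m} (suc i) with succ-wrap {m} i | pred-succ {m} i
  ... | zero | eq = cong suc eq
  ... | suc j | eq = cong suc eq

γ : ∀ m → Permutation′ (suc m)
γ m = permutation succ-wrap pred-wrap succ-pred pred-succ

_^_ : ∀ {A : Set} → (A → A) → ℕ → (A → A)
(f ^ zero) x = x
(f ^ suc k) x = f ((f ^ k) x)

-- Left to right: as π′ ≠ π, some i has π i < π′ i, for otherwise π′ ∘ π⁻¹ would be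
-- a permutation of [n] that never increases a point, hence the identity.  Rotating by
-- γ^k with k = n − π i moves π i to n, and γ^j with j = n − π′ i moves π′ i to n,
-- so ρ = γ^j ∘ π′ ∘ π⁻¹ ∘ γ^(−k) fixes n and satisfies π′ = γ^(−j) ∘ ρ ∘ γ^k ∘ π.
-- Right to left: if π′ = π, then ρ ∘ γ^k = γ^j; evaluating at the point y with
-- γ^k y = n gives γ^j y = n, impossible since y + j < y + k = n.
module Submission where

open import Defs
open import Data.Nat using (ℕ; _≤_; _<_; suc)
open import Data.Fin using (Fin; fromℕ)
open import Data.Fin.Permutation using (Permutation′; _⟨$⟩ʳ_; _⟨$⟩ˡ_)
open import Data.Product using (Σ; ∃; _×_)
open import Relation.Binary.PropositionalEquality using (_≡_)
open import Relation.Nullary using (¬_)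
open import Function.Bundles using (_⇔_)

open import Data.Nat using (zero; _+_; _∸_; _<?_; s≤s)
open import Data.Nat.Properties
  using (≤-refl; ≤-trans; <-≤-trans; <⇒≤; <⇒≢; ≤-pred; ≮⇒≥; m≤n⇒m<n∨m≡n;
         +-identityʳ; +-suc; +-comm; +-monoʳ-<; m∸n≤m; m∸n+n≡m; ∸-monoʳ-<)
open import Data.Fin using (toℕ; zero; suc; fromℕ<)
open import Data.Fin.Properties using (toℕ-injective; toℕ-fromℕ; toℕ-fromℕ<; toℕ<n; any?)
open import Data.Fin.Permutation using (id; flip; _∘ₚ_; inverseˡ; inverseʳ)
open import Data.Product using (_,_)
open import Data.Sum using (inj₁; inj₂)
open import Relation.Binary.PropositionalEquality using (_≢_; refl; sym; trans; cong; subst; module ≡-Reasoning)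
open import Relation.Nullary using (yes; no; contradiction)
open import Function.Bundles using (mk⇔)

^-suc : ∀ {A : Set} (f : A → A) k x → (f ^ k) (f x) ≡ f ((f ^ k) x)
^-suc f zero    x = refl
^-suc f (suc k) x = cong f (^-suc f k x)

^-inverse : ∀ {A : Set} {f g : A → A} → (∀ x → g (f x) ≡ x) → ∀ k x → (g ^ k) ((f ^ k) x) ≡ x
^-inverse _      zero    x = refl
^-inverse {f = f} {g} g∘f≗id (suc k) x = begin
  g ((g ^ k) (f ((f ^ k) x)))  ≡⟨ sym (^-suc g k _) ⟩
  (g ^ k) (g (f ((f ^ k) x)))  ≡⟨ cong (g ^ k) (g∘f≗id _) ⟩
  (g ^ k) ((f ^ k) x)          ≡⟨ ^-inverse g∘f≗id k x ⟩
  x                            ∎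
  where open ≡-Reasoning

module _ {n : ℕ} where

  pow : Permutation′ n → ℕ → Permutation′ n
  pow g zero    = id
  pow g (suc k) = pow g k ∘ₚ g

  pow-⟨$⟩ʳ : ∀ g k (x : Fin n) → pow g k ⟨$⟩ʳ x ≡ ((g ⟨$⟩ʳ_) ^ k) x
  pow-⟨$⟩ʳ g zero    x = refl
  pow-⟨$⟩ʳ g (suc k) x = cong (g ⟨$⟩ʳ_) (pow-⟨$⟩ʳ g k x)

  pow-⟨$⟩ˡ-^ : ∀ g k (x : Fin n) → pow g k ⟨$⟩ˡ ((g ⟨$⟩ʳ_) ^ k) x ≡ x
  pow-⟨$⟩ˡ-^ g k x = trans (cong (pow g k ⟨$⟩ˡ_) (sym (pow-⟨$⟩ʳ g k x))) (inverseˡ (pow g k))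

  relabel : (g π π′ : Permutation′ n) (j k : ℕ) → Permutation′ n
  relabel g π π′ j k = flip (pow g k) ∘ₚ flip π ∘ₚ π′ ∘ₚ pow g j

  relabel-factorises : ∀ g π π′ j k (i : Fin n) →
    π′ ⟨$⟩ʳ i ≡ ((g ⟨$⟩ˡ_) ^ j) (relabel g π π′ j k ⟨$⟩ʳ ((g ⟨$⟩ʳ_) ^ k) (π ⟨$⟩ʳ i))
  relabel-factorises g π π′ j k i = sym (begin
    G⁻ʲ (pow g j ⟨$⟩ʳ (π′ ⟨$⟩ʳ (π ⟨$⟩ˡ (pow g k ⟨$⟩ˡ ((g ⟨$⟩ʳ_) ^ k) (π ⟨$⟩ʳ i)))))
      ≡⟨ cong (λ z → G⁻ʲ (pow g j ⟨$⟩ʳ (π′ ⟨$⟩ʳ (π ⟨$⟩ˡ z)))) (pow-⟨$⟩ˡ-^ g k _) ⟩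
    G⁻ʲ (pow g j ⟨$⟩ʳ (π′ ⟨$⟩ʳ (π ⟨$⟩ˡ (π ⟨$⟩ʳ i))))
      ≡⟨ cong (λ z → G⁻ʲ (pow g j ⟨$⟩ʳ (π′ ⟨$⟩ʳ z))) (inverseˡ π) ⟩
    G⁻ʲ (pow g j ⟨$⟩ʳ (π′ ⟨$⟩ʳ i))
      ≡⟨ cong G⁻ʲ (pow-⟨$⟩ʳ g j _) ⟩
    G⁻ʲ (((g ⟨$⟩ʳ_) ^ j) (π′ ⟨$⟩ʳ i))
      ≡⟨ ^-inverse (λ _ → inverseˡ g) j _ ⟩
    π′ ⟨$⟩ʳ i ∎)
    where
    open ≡-Reasoning
    G⁻ʲ = (g ⟨$⟩ˡ_) ^ j

  relabel-fixes : ∀ g π π′ j k (i z : Fin n) →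
    ((g ⟨$⟩ʳ_) ^ k) (π ⟨$⟩ʳ i) ≡ z → ((g ⟨$⟩ʳ_) ^ j) (π′ ⟨$⟩ʳ i) ≡ z →
    relabel g π π′ j k ⟨$⟩ʳ z ≡ z
  relabel-fixes g π π′ j k i z πi↦z π′i↦z = begin
    pow g j ⟨$⟩ʳ (π′ ⟨$⟩ʳ (π ⟨$⟩ˡ (pow g k ⟨$⟩ˡ z)))
      ≡⟨ cong (λ w → pow g j ⟨$⟩ʳ (π′ ⟨$⟩ʳ (π ⟨$⟩ˡ (pow g k ⟨$⟩ˡ w)))) (sym πi↦z) ⟩
    pow g j ⟨$⟩ʳ (π′ ⟨$⟩ʳ (π ⟨$⟩ˡ (pow g k ⟨$⟩ˡ ((g ⟨$⟩ʳ_) ^ k) (π ⟨$⟩ʳ i))))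
      ≡⟨ cong (λ w → pow g j ⟨$⟩ʳ (π′ ⟨$⟩ʳ (π ⟨$⟩ˡ w))) (pow-⟨$⟩ˡ-^ g k _) ⟩
    pow g j ⟨$⟩ʳ (π′ ⟨$⟩ʳ (π ⟨$⟩ˡ (π ⟨$⟩ʳ i)))
      ≡⟨ cong (λ w → pow g j ⟨$⟩ʳ (π′ ⟨$⟩ʳ w)) (inverseˡ π) ⟩
    pow g j ⟨$⟩ʳ (π′ ⟨$⟩ʳ i)
      ≡⟨ trans (pow-⟨$⟩ʳ g j _) π′i↦z ⟩
    z ∎
    where open ≡-Reasoning

  non-increasing⇒≗id : (σ : Permutation′ n) → (∀ a → toℕ (σ ⟨$⟩ʳ a) ≤ toℕ a) → ∀ a → σ ⟨$⟩ʳ a ≡ a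
  non-increasing⇒≗id σ σa≤a a = below (suc (toℕ a)) a ≤-refl
    where
    below : ∀ t a → toℕ a < t → σ ⟨$⟩ʳ a ≡ a
    below (suc t) a (s≤s a≤t) with m≤n⇒m<n∨m≡n (σa≤a a)
    ... | inj₂ σa≡a = toℕ-injective σa≡a
    ... | inj₁ σa<a = contradiction (cong toℕ (sym a≡b)) (<⇒≢ σa<a)
      where
      b : Fin n
      b = σ ⟨$⟩ʳ a
      σb≡b : σ ⟨$⟩ʳ b ≡ b
      σb≡b = below t b (<-≤-trans σa<a a≤t)
      a≡b : a ≡ b
      a≡b = trans (sym (inverseˡ σ)) (trans (cong (σ ⟨$⟩ˡ_) (sym σb≡b)) (inverseˡ σ))

  ≢⇒∃-moved-up : (π π′ : Permutation′ n) → ¬ (∀ i → π′ ⟨$⟩ʳ i ≡ π ⟨$⟩ʳ i) →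
    ∃ λ i → toℕ (π ⟨$⟩ʳ i) < toℕ (π′ ⟨$⟩ʳ i)
  ≢⇒∃-moved-up π π′ π′≢π with any? (λ i → toℕ (π ⟨$⟩ʳ i) <? toℕ (π′ ⟨$⟩ʳ i))
  ... | yes moved = moved
  ... | no ¬moved = contradiction π′≗π π′≢π
    where
    σ : Permutation′ n
    σ = flip π ∘ₚ π′
    σ≗id : ∀ a → σ ⟨$⟩ʳ a ≡ a
    σ≗id = non-increasing⇒≗id σ λ a →
      subst (toℕ (σ ⟨$⟩ʳ a) ≤_) (cong toℕ (inverseʳ π)) (≮⇒≥ λ lt → ¬moved (π ⟨$⟩ˡ a , lt))
    π′≗π : ∀ i → π′ ⟨$⟩ʳ i ≡ π ⟨$⟩ʳ i
    π′≗π i = trans (cong (π′ ⟨$⟩ʳ_) (sym (inverseˡ π))) (σ≗id (π ⟨$⟩ʳ i))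

toℕ-succ-wrap : ∀ {m} (x : Fin (suc m)) → toℕ x < m → toℕ (succ-wrap x) ≡ suc (toℕ x)
toℕ-succ-wrap {suc m} zero    _ = refl
toℕ-succ-wrap {suc m} (suc i) (s≤s i<m) with succ-wrap {m} i | toℕ-succ-wrap i i<m
... | suc _ | eq = cong suc eq

toℕ-succ-wrap-^ : ∀ {m} k (x : Fin (suc m)) → toℕ x + k ≤ m → toℕ ((succ-wrap ^ k) x) ≡ toℕ x + k
toℕ-succ-wrap-^ zero    x _ = sym (+-identityʳ _)
toℕ-succ-wrap-^ {m} (suc k) x x+1+k≤m = begin
  toℕ (succ-wrap ((succ-wrap ^ k) x)) ≡⟨ toℕ-succ-wrap _ (subst (_< m) (sym ih) x+k<m) ⟩
  suc (toℕ ((succ-wrap ^ k) x))       ≡⟨ cong suc ih ⟩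
  suc (toℕ x + k)                     ≡⟨ sym (+-suc _ k) ⟩
  toℕ x + suc k                       ∎
  where
  open ≡-Reasoning
  x+k<m : toℕ x + k < m
  x+k<m = subst (_≤ m) (+-suc _ k) x+1+k≤m
  ih : toℕ ((succ-wrap ^ k) x) ≡ toℕ x + k
  ih = toℕ-succ-wrap-^ k x (<⇒≤ x+k<m)

succ-wrap-^-reaches-last : ∀ {m} k (x : Fin (suc m)) → toℕ x + k ≡ m → (succ-wrap ^ k) x ≡ fromℕ m
succ-wrap-^-reaches-last {m} k x x+k≡m = toℕ-injective (begin
  toℕ ((succ-wrap ^ k) x) ≡⟨ toℕ-succ-wrap-^ k x (subst (_≤ m) (sym x+k≡m) ≤-refl) ⟩
  toℕ x + k               ≡⟨ x+k≡m ⟩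
  m                       ≡⟨ sym (toℕ-fromℕ m) ⟩
  toℕ (fromℕ m)           ∎)
  where open ≡-Reasoning

succ-wrap-^-misses-last : ∀ {m} k (x : Fin (suc m)) → toℕ x + k < m → (succ-wrap ^ k) x ≢ fromℕ m
succ-wrap-^-misses-last {m} k x x+k<m reaches = <⇒≢ x+k<m (begin
  toℕ x + k               ≡⟨ sym (toℕ-succ-wrap-^ k x (<⇒≤ x+k<m)) ⟩
  toℕ ((succ-wrap ^ k) x) ≡⟨ cong toℕ reaches ⟩
  toℕ (fromℕ m)           ≡⟨ toℕ-fromℕ m ⟩
  m                       ∎)
  where open ≡-Reasoning

factorisation⇒≢ : ∀ m (π π′ ρ : Permutation′ (suc m)) j k → j < k → k ≤ m →
  ρ ⟨$⟩ʳ fromℕ m ≡ fromℕ m →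
  (∀ i → π′ ⟨$⟩ʳ i ≡ ((γ m ⟨$⟩ˡ_) ^ j) (ρ ⟨$⟩ʳ ((γ m ⟨$⟩ʳ_) ^ k) (π ⟨$⟩ʳ i))) →
  ¬ (∀ i → π′ ⟨$⟩ʳ i ≡ π ⟨$⟩ʳ i)
factorisation⇒≢ m π π′ ρ j k j<k k≤m ρ-fixes factorises π′≗π =
  succ-wrap-^-misses-last j y y+j<m (begin
    (succ-wrap ^ j) y                                    ≡⟨ cong (succ-wrap ^ j) y≡γ⁻ʲlast ⟩
    (succ-wrap ^ j) (((γ m ⟨$⟩ˡ_) ^ j) (fromℕ m))        ≡⟨ ^-inverse (λ _ → inverseʳ (γ m)) j _ ⟩
    fromℕ m                                              ∎)
  where
  open ≡-Reasoning
  y : Fin (suc m)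
  y = fromℕ< (s≤s (m∸n≤m m k))
  toℕ-y : toℕ y ≡ m ∸ k
  toℕ-y = toℕ-fromℕ< (s≤s (m∸n≤m m k))
  y+j<m : toℕ y + j < m
  y+j<m = subst (_< m) (cong (_+ j) (sym toℕ-y))
            (subst (m ∸ k + j <_) (m∸n+n≡m k≤m) (+-monoʳ-< (m ∸ k) j<k))
  y≡γ⁻ʲlast : y ≡ ((γ m ⟨$⟩ˡ_) ^ j) (fromℕ m)
  y≡γ⁻ʲlast = begin
    y                                                    ≡⟨ sym (inverseʳ π) ⟩
    π ⟨$⟩ʳ (π ⟨$⟩ˡ y)                                    ≡⟨ sym (π′≗π _) ⟩
    π′ ⟨$⟩ʳ (π ⟨$⟩ˡ y)                                   ≡⟨ factorises _ ⟩
    ((γ m ⟨$⟩ˡ_) ^ j) (ρ ⟨$⟩ʳ (succ-wrap ^ k) (π ⟨$⟩ʳ (π ⟨$⟩ˡ y)))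
      ≡⟨ cong (λ z → ((γ m ⟨$⟩ˡ_) ^ j) (ρ ⟨$⟩ʳ (succ-wrap ^ k) z)) (inverseʳ π) ⟩
    ((γ m ⟨$⟩ˡ_) ^ j) (ρ ⟨$⟩ʳ (succ-wrap ^ k) y)
      ≡⟨ cong (λ z → ((γ m ⟨$⟩ˡ_) ^ j) (ρ ⟨$⟩ʳ z))
              (succ-wrap-^-reaches-last k y (trans (cong (_+ k) toℕ-y) (m∸n+n≡m k≤m))) ⟩
    ((γ m ⟨$⟩ˡ_) ^ j) (ρ ⟨$⟩ʳ fromℕ m)                   ≡⟨ cong ((γ m ⟨$⟩ˡ_) ^ j) ρ-fixes ⟩
    ((γ m ⟨$⟩ˡ_) ^ j) (fromℕ m)                          ∎

≢⇒factorisation : ∀ m (π π′ : Permutation′ (suc m)) → ¬ (∀ i → π′ ⟨$⟩ʳ i ≡ π ⟨$⟩ʳ i) →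
  Σ ℕ λ j → Σ ℕ λ k → j < k × k < suc m ×
    Σ (Permutation′ (suc m)) λ ρ → ρ ⟨$⟩ʳ fromℕ m ≡ fromℕ m ×
      (∀ i → π′ ⟨$⟩ʳ i ≡ ((γ m ⟨$⟩ˡ_) ^ j) (ρ ⟨$⟩ʳ ((γ m ⟨$⟩ʳ_) ^ k) (π ⟨$⟩ʳ i)))
≢⇒factorisation m π π′ π′≢π with ≢⇒∃-moved-up π π′ π′≢π
... | i , πi<π′i =
  j , k , ∸-monoʳ-< πi<π′i π′i≤m , s≤s (m∸n≤m m (toℕ (π ⟨$⟩ʳ i))) ,
  relabel (γ m) π π′ j k ,
  relabel-fixes (γ m) π π′ j k i (fromℕ m)
    (succ-wrap-^-reaches-last k _ (trans (+-comm _ k) (m∸n+n≡m (≤-trans (<⇒≤ πi<π′i) π′i≤m))))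
    (succ-wrap-^-reaches-last j _ (trans (+-comm _ j) (m∸n+n≡m π′i≤m))) ,
  relabel-factorises (γ m) π π′ j k
  where
  π′i≤m : toℕ (π′ ⟨$⟩ʳ i) ≤ m
  π′i≤m = ≤-pred (toℕ<n _)
  j k : ℕ
  j = m ∸ toℕ (π′ ⟨$⟩ʳ i)
  k = m ∸ toℕ (π ⟨$⟩ʳ i)

lemma7p2 : (m : ℕ) → 3 ≤ suc m → (π π′ : Permutation′ (suc m)) →
    (¬ (∀ i → π′ ⟨$⟩ʳ i ≡ π ⟨$⟩ʳ i))
      ⇔ (Σ ℕ λ j → Σ ℕ λ k → j < k × k < suc m ×
           Σ (Permutation′ (suc m)) λ ρ → ρ ⟨$⟩ʳ fromℕ m ≡ fromℕ m ×
             (∀ i → π′ ⟨$⟩ʳ i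
                    ≡ ((γ m ⟨$⟩ˡ_) ^ j) (ρ ⟨$⟩ʳ (((γ m ⟨$⟩ʳ_) ^ k) (π ⟨$⟩ʳ i)))))
lemma7p2 m _ π π′ = mk⇔ (≢⇒factorisation m π π′)
  λ (j , k , j<k , k<n , ρ , ρ-fixes , factorises) →
    factorisation⇒≢ m π π′ ρ j k j<k (≤-pred k<n) ρ-fixes factorises
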